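{- Let $K$ be a field of characteristic $0$ and let $(1,R_1,R_2,\dots)$ be a sprout sequence with seed $F(t)\in K[[t]]$, $F(0)=1$. Then $(1,\omega R_1,\omega R_2,\dots)$ is a sprout sequence with seed $\frac{1}{F(-t)}$.
   Context: A sequence $(R_0=1,R_1,R_2,\dots)$ of symmetric functions in $\boldsymbol{x}=(x_1,x_2,\dots)$ is a sprout sequence with seed $F(t)=1+a_1t+\cdots$ if $\sum_{n\ge0}R_nt^n=\prod_{i\ge1}F(x_it)$. $\omega$ is the standard involutive automorphism of the ring of symmetric functions with $\omega(h_n)=e_n$ (equivalently $\omega p_n=(-1)^{n-1}p_n$). -}

module Defs where

open import Level using (Level; _⊔_)
open import Algebra.Bundles using (CommutativeRing)
open import Data.Nat as ℕ using (ℕ; zero; suc; _≟_; _≤?_)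
open import Data.List using (List; []; _∷_; _++_; map; foldr; concatMap)
open import Data.Product using (Σ; _×_; ∃)
open import Relation.Nullary using (¬_; yes; no)

natK : ∀ {c ℓ} (R : CommutativeRing c ℓ) → ℕ → CommutativeRing.Carrier R
natK R zero    = CommutativeRing.0# R
natK R (suc n) = CommutativeRing._+_ R (CommutativeRing.1# R) (natK R n)

record CharZeroField (c ℓ : Level) : Set (Level.suc (c ⊔ ℓ)) where
  field
    commRing : CommutativeRing c ℓ
  open CommutativeRing commRing
  field
    nontrivial : ¬ (0# ≈ 1#)
    inverse    : ∀ x → ¬ (x ≈ 0#) → Σ Carrier (λ y → x * y ≈ 1#)
    charZero   : ∀ n → ¬ (natK commRing (suc n) ≈ 0#)

-- A monomial x₁^{α₁} x₂^{α₂} ⋯ x_k^{α_k} is encoded by its exponent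
-- list (α₁ , … , α_k); all further exponents are 0.  Hence lists that
-- differ by trailing zeros denote the same monomial.
Monomial : Set
Monomial = List ℕ

deg : Monomial → ℕ
deg = foldr ℕ._+_ 0

-- swap the exponents of x_{i+1} and x_{i+2} (no-op if the list is too short)
swapAt : ℕ → Monomial → Monomial
swapAt zero    (a ∷ b ∷ as) = b ∷ a ∷ as
swapAt zero    as           = as
swapAt (suc i) []           = []
swapAt (suc i) (a ∷ as)     = a ∷ swapAt i as

-- all β (of the same length) with β ≤ α componentwise, paired with α - β
splits : Monomial → List (Monomial × Monomial)
splits []       = ([] Data.Product., [])  ∷ []
splits (a ∷ as) =
  concatMap (λ p → map (λ k → (k ∷ Data.Product.proj₁ p) Data.Product., ((a ℕ.∸ k) ∷ Data.Product.proj₂ p))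
                       (Data.List.upTo (suc a)))
            (splits as)

module Sym {c ℓ : Level} (K : CommutativeRing c ℓ) where
  open CommutativeRing K hiding (zero; Carrier; _≈_; 0#; 1#)
  open CommutativeRing K public using (Carrier; _≈_; 0#; 1#)

  Series : Set c
  Series = Monomial → Carrier

  _≋_ : Series → Series → Set ℓ
  f ≋ g = ∀ α → f α ≈ g α
  infix 4 _≋_

  _⊕_ : Series → Series → Series
  (f ⊕ g) α = f α + g α

  _·_ : Carrier → Series → Series
  (k · f) α = k * f α

  _⊛_ : Series → Series → Series
  (f ⊛ g) α = foldr _+_ 0# (map (λ p → f (Data.Product.proj₁ p) * g (Data.Product.proj₂ p)) (splits α))

  isZeroMonomial : Monomial → Carrier
  isZeroMonomial α with deg α ≟ 0
  ... | yes _ = 1#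
  ... | no  _ = 0#

  oneS : Series
  oneS = isZeroMonomial

  hS : ℕ → Series
  hS n α with deg α ≟ n
  ... | yes _ = 1#
  ... | no  _ = 0#

  prodMap : (ℕ → Carrier) → Monomial → Carrier
  prodMap a = foldr (λ k r → a k * r) 1#

  eS : ℕ → Series
  eS n α with deg α ≟ n
  ... | no  _ = 0#
  ... | yes _ = prodMap e01 α
    where
      -- product of e01(αᵢ) is 1 iff all αᵢ ≤ 1, else 0
      e01 : ℕ → Carrier
      e01 0 = 1#
      e01 1 = 1#
      e01 _ = 0#

  -- a series is a symmetric function: it is insensitive to trailing
  -- zeros (so it is a well-defined function of monomials), invariant
  -- under all adjacent transpositions of variables (which generate all
  -- finitary permutations), and has bounded degree.
  record IsSymFun (f : Series) : Set (c ⊔ ℓ) where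
    field
      padding   : ∀ α → f (α ++ (0 ∷ [])) ≈ f α
      symmetric : ∀ i α → f (swapAt i α) ≈ f α
      bounded   : ∃ λ d → ∀ α → d ℕ.< deg α → f α ≈ 0#

  Λ : Set (c ⊔ ℓ)
  Λ = Σ Series IsSymFun

  ser : Λ → Series
  ser = Data.Product.proj₁

  -- ω : Λ → Λ is a K-algebra homomorphism with ω(h_n) = e_n for all n.
  -- (Such a map exists and is unique; it is the involution ω.)
  -- The operations are stated relationally on the underlying series.
  record IsOmega (ω : Λ → Λ) : Set (c ⊔ ℓ) where
    field
      ω-one   : ∀ f → ser f ≋ oneS → ser (ω f) ≋ oneS
      ω-add   : ∀ f g h → ser h ≋ ser f ⊕ ser g → ser (ω h) ≋ ser (ω f) ⊕ ser (ω g)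
      ω-scal  : ∀ k f h → ser h ≋ k · ser f → ser (ω h) ≋ k · ser (ω f)
      ω-mul   : ∀ f g h → ser h ≋ ser f ⊛ ser g → ser (ω h) ≋ ser (ω f) ⊛ ser (ω g)
      ω-h     : ∀ n f → ser f ≋ hS n → ser (ω f) ≋ eS n

  Seed : Set c
  Seed = ℕ → Carrier

  -- coefficient of t^n in ∏_{i ≥ 1} F(x_i t): the coefficient of x^α is
  -- [deg α = n] · ∏_i F_{α_i}   (using F_0 = 1)
  sproutCoeff : Seed → ℕ → Series
  sproutCoeff F n α with deg α ≟ n
  ... | yes _ = prodMap F α
  ... | no  _ = 0#

  IsSprout : (ℕ → Λ) → Seed → Set ℓ
  IsSprout R F = ∀ n → ser (R n) ≋ sproutCoeff F n

  sumTo : ℕ → (ℕ → Carrier) → Carrier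
  sumTo zero    f = f zero
  sumTo (suc n) f = sumTo n f + f (suc n)

  signed : ℕ → Carrier → Carrier
  signed zero          x = x
  signed (suc zero)    x = - x
  signed (suc (suc k)) x = signed k x

  -- the series F(-t) has coefficients (-1)^k F_k
  negArg : Seed → Seed
  negArg F k = signed k (F k)

  delta0 : ℕ → Carrier
  delta0 zero    = 1#
  delta0 (suc _) = 0#

  IsInverseSeries : Seed → Seed → Set ℓ
  IsInverseSeries G H = ∀ n → sumTo n (λ k → G k * H (n ℕ.∸ k)) ≈ delta0 n

module Submission where

-- Applying the Euler operator t d/dt to ∏_i F(x_i t) turns the sprout sequence
-- into Newton's identity  n R_n = Σ_k d_k p_k R_{n-k},  where Σ_k d_k t^k =
-- t F′(t)/F(t) and p_k is the k-th power sum.  Comparing the identities for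
-- h_n (seed 1/(1-t)) and e_n (seed 1+t) after applying ω gives
-- ω p_k = (-1)^{k-1} p_k, so ω R_n satisfies Newton's identity with
-- coefficients (-1)^{k-1} d_k.  These are the coefficients of the logarithmic
-- derivative of G = 1/F(-t), so ω R_n and the sprout sequence of G satisfy the
-- same recursion; in characteristic 0 it determines the sequence from its
-- first term 1.

open import Level using (Level)
open import Algebra.Bundles using (CommutativeRing)
import Algebra.Properties.Ring as RingProperties
import Algebra.Solver.Ring.NaturalCoefficients as NaturalCoefficients
open import Data.Empty using (⊥-elim)
open import Data.List using (List; []; _∷_; _++_; map; foldr; concatMap; applyUpTo; upTo)
open import Data.Maybe using (nothing)
open import Data.Nat as ℕ using (ℕ; zero; suc; _∸_; z≤n; s≤s) renaming (_+_ to _+ℕ_)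
import Data.Nat.Properties as ℕₚ
open import Data.Nat.Induction using (<-rec)
open import Algebra.Properties.CommutativeSemigroup ℕₚ.+-commutativeSemigroup
  using (interchange; x∙yz≈y∙xz)
open import Data.Product using (_×_; _,_; proj₁; proj₂)
open import Data.Sum using (_⊎_; inj₁; inj₂)
open import Relation.Binary.PropositionalEquality as ≡ using (_≡_; _≢_)
open import Relation.Nullary using (yes; no)
open import Defs

module _ {c ℓ : Level} (K : CommutativeRing c ℓ) where
  open CommutativeRing K
  open import Relation.Binary.Reasoning.Setoid setoid

  invertible-*-cancelˡ : ∀ {a b x y} → a * b ≈ 1# → a * x ≈ a * y → x ≈ y
  invertible-*-cancelˡ {a} {b} {x} {y} ab≈1 ax≈ay = begin
    x           ≈⟨ *-identityˡ x ⟨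
    1# * x      ≈⟨ *-congʳ ab≈1 ⟨
    (a * b) * x ≈⟨ trans (*-congʳ (*-comm a b)) (*-assoc b a x) ⟩
    b * (a * x) ≈⟨ *-congˡ ax≈ay ⟩
    b * (a * y) ≈⟨ trans (*-congʳ (*-comm a b)) (*-assoc b a y) ⟨
    (a * b) * y ≈⟨ *-congʳ ab≈1 ⟩
    1# * y      ≈⟨ *-identityˡ y ⟩
    y           ∎

module FiniteSums {c ℓ : Level} (K : CommutativeRing c ℓ) where
  open CommutativeRing K hiding (zero)
  open Sym K using (sumTo)
  open import Relation.Binary.Reasoning.Setoid setoid
  open NaturalCoefficients commutativeSemiring (λ _ _ → nothing) using (solve; _:=_; _:+_)

  sumTo-cong-≤ : ∀ n {f g : ℕ → Carrier} → (∀ k → k ℕ.≤ n → f k ≈ g k) → sumTo n f ≈ sumTo n g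
  sumTo-cong-≤ zero    f≈g = f≈g 0 z≤n
  sumTo-cong-≤ (suc n) f≈g =
    +-cong (sumTo-cong-≤ n (λ k k≤n → f≈g k (ℕₚ.m≤n⇒m≤1+n k≤n))) (f≈g (suc n) ℕₚ.≤-refl)

  sumTo-cong : ∀ n {f g : ℕ → Carrier} → (∀ k → f k ≈ g k) → sumTo n f ≈ sumTo n g
  sumTo-cong n f≈g = sumTo-cong-≤ n (λ k _ → f≈g k)

  sumTo-zero : ∀ n {f : ℕ → Carrier} → (∀ k → k ℕ.≤ n → f k ≈ 0#) → sumTo n f ≈ 0#
  sumTo-zero zero    f≈0 = f≈0 0 z≤n
  sumTo-zero (suc n) f≈0 =
    trans (+-cong (sumTo-zero n (λ k k≤n → f≈0 k (ℕₚ.m≤n⇒m≤1+n k≤n))) (f≈0 (suc n) ℕₚ.≤-refl))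
          (+-identityˡ 0#)

  sumTo-+ : ∀ n (f g : ℕ → Carrier) → sumTo n (λ k → f k + g k) ≈ sumTo n f + sumTo n g
  sumTo-+ zero    f g = refl
  sumTo-+ (suc n) f g = begin
    sumTo n (λ k → f k + g k) + (f (suc n) + g (suc n))
      ≈⟨ +-congʳ (sumTo-+ n f g) ⟩
    (sumTo n f + sumTo n g) + (f (suc n) + g (suc n))
      ≈⟨ solve 4 (λ a b x y → (a :+ b) :+ (x :+ y) := (a :+ x) :+ (b :+ y)) refl _ _ _ _ ⟩
    (sumTo n f + f (suc n)) + (sumTo n g + g (suc n)) ∎

  sumTo-*ˡ : ∀ n a (f : ℕ → Carrier) → sumTo n (λ k → a * f k) ≈ a * sumTo n f
  sumTo-*ˡ zero    a f = refl
  sumTo-*ˡ (suc n) a f = trans (+-congʳ (sumTo-*ˡ n a f)) (sym (distribˡ a _ _))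

  sumTo-*ʳ : ∀ n a (f : ℕ → Carrier) → sumTo n (λ k → f k * a) ≈ sumTo n f * a
  sumTo-*ʳ zero    a f = refl
  sumTo-*ʳ (suc n) a f = trans (+-congʳ (sumTo-*ʳ n a f)) (sym (distribʳ a _ _))

  sumTo-sucˡ : ∀ n (f : ℕ → Carrier) → sumTo (suc n) f ≈ f 0 + sumTo n (λ k → f (suc k))
  sumTo-sucˡ zero    f = refl
  sumTo-sucˡ (suc n) f = trans (+-congʳ (sumTo-sucˡ n f)) (+-assoc _ _ _)

  sumTo-swap : ∀ n m (g : ℕ → ℕ → Carrier) →
               sumTo n (λ i → sumTo m (g i)) ≈ sumTo m (λ j → sumTo n (λ i → g i j))
  sumTo-swap zero    m g = refl
  sumTo-swap (suc n) m g = begin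
    sumTo n (λ i → sumTo m (g i)) + sumTo m (g (suc n))            ≈⟨ +-congʳ (sumTo-swap n m g) ⟩
    sumTo m (λ j → sumTo n (λ i → g i j)) + sumTo m (g (suc n))   ≈⟨ sumTo-+ m _ _ ⟨
    sumTo m (λ j → sumTo n (λ i → g i j) + g (suc n) j)           ∎

  sumTo-reverse : ∀ n (f : ℕ → Carrier) → sumTo n f ≈ sumTo n (λ k → f (n ∸ k))
  sumTo-reverse zero    f = refl
  sumTo-reverse (suc n) f = begin
    sumTo n f + f (suc n)                 ≈⟨ +-congʳ (sumTo-reverse n f) ⟩
    sumTo n (λ k → f (n ∸ k)) + f (suc n) ≈⟨ +-comm _ _ ⟩
    f (suc n) + sumTo n (λ k → f (n ∸ k)) ≈⟨ sumTo-sucˡ n (λ k → f (suc n ∸ k)) ⟨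
    sumTo (suc n) (λ k → f (suc n ∸ k))   ∎

  sumTo-triangle : ∀ n (g : ℕ → ℕ → Carrier) →
                   sumTo n (λ m → sumTo m (λ i → g i (m ∸ i))) ≈ sumTo n (λ i → sumTo (n ∸ i) (g i))
  sumTo-triangle zero    g = refl
  sumTo-triangle (suc n) g = begin
    sumTo n (λ m → sumTo m (λ i → g i (m ∸ i))) + (sumTo n (λ i → g i (suc n ∸ i)) + g (suc n) (n ∸ n))
      ≈⟨ +-assoc _ _ _ ⟨
    (sumTo n (λ m → sumTo m (λ i → g i (m ∸ i))) + sumTo n (λ i → g i (suc n ∸ i))) + g (suc n) (n ∸ n)
      ≈⟨ +-congʳ (+-congʳ (sumTo-triangle n g)) ⟩
    (sumTo n (λ i → sumTo (n ∸ i) (g i)) + sumTo n (λ i → g i (suc n ∸ i))) + g (suc n) (n ∸ n)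
      ≈⟨ +-congʳ (sumTo-+ n _ _) ⟨
    sumTo n (λ i → sumTo (n ∸ i) (g i) + g i (suc n ∸ i)) + g (suc n) (n ∸ n)
      ≈⟨ +-cong (sumTo-cong-≤ n (λ i i≤n → reflexive (≡.sym (sumTo-∸-suc i i≤n))))
                (reflexive lastColumn) ⟩
    sumTo n (λ i → sumTo (suc n ∸ i) (g i)) + sumTo (n ∸ n) (g (suc n)) ∎
    where
    sumTo-∸-suc : ∀ i → i ℕ.≤ n → sumTo (suc n ∸ i) (g i) ≡ sumTo (n ∸ i) (g i) + g i (suc n ∸ i)
    sumTo-∸-suc i i≤n rewrite ℕₚ.+-∸-assoc 1 i≤n = ≡.refl
    lastColumn : g (suc n) (n ∸ n) ≡ sumTo (n ∸ n) (g (suc n))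
    lastColumn rewrite ℕₚ.n∸n≡0 n = ≡.refl

  kronecker : ℕ → ℕ → Carrier
  kronecker zero    zero    = 1#
  kronecker zero    (suc j) = 0#
  kronecker (suc i) zero    = 0#
  kronecker (suc i) (suc j) = kronecker i j

  kronecker-refl : ∀ j → kronecker j j ≡ 1#
  kronecker-refl zero    = ≡.refl
  kronecker-refl (suc j) = kronecker-refl j

  kronecker-≢ : ∀ i j → i ≢ j → kronecker i j ≡ 0#
  kronecker-≢ zero    zero    i≢j = ⊥-elim (i≢j ≡.refl)
  kronecker-≢ zero    (suc j) i≢j = ≡.refl
  kronecker-≢ (suc i) zero    i≢j = ≡.refl
  kronecker-≢ (suc i) (suc j) i≢j = kronecker-≢ i j (λ i≡j → i≢j (≡.cong suc i≡j))

  kronecker-≢-* : ∀ i j x → i ≢ j → kronecker i j * x ≈ 0#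
  kronecker-≢-* i j x i≢j = trans (*-congʳ (reflexive (kronecker-≢ i j i≢j))) (zeroˡ x)

  sumTo-kronecker : ∀ n j (g : ℕ → Carrier) → j ℕ.≤ n → sumTo n (λ k → kronecker k j * g k) ≈ g j
  sumTo-kronecker zero    j g z≤n = *-identityˡ _
  sumTo-kronecker (suc n) j g j≤1+n with j ℕ.≟ suc n
  ... | yes ≡.refl = begin
    sumTo n (λ k → kronecker k (suc n) * g k) + kronecker (suc n) (suc n) * g (suc n)
      ≈⟨ +-cong (sumTo-zero n (λ k k≤n →
                   kronecker-≢-* k (suc n) _ (λ k≡1+n → ℕₚ.<-irrefl k≡1+n (s≤s k≤n))))
                (trans (*-congʳ (reflexive (kronecker-refl (suc n)))) (*-identityˡ _)) ⟩
    0# + g (suc n) ≈⟨ +-identityˡ _ ⟩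
    g (suc n)      ∎
  ... | no j≢1+n = begin
    sumTo n (λ k → kronecker k j * g k) + kronecker (suc n) j * g (suc n)
      ≈⟨ +-cong (sumTo-kronecker n j g (ℕₚ.≤-pred (ℕₚ.≤∧≢⇒< j≤1+n j≢1+n)))
                (kronecker-≢-* (suc n) j _ (λ 1+n≡j → j≢1+n (≡.sym 1+n≡j))) ⟩
    g j + 0# ≈⟨ +-identityʳ _ ⟩
    g j      ∎

module PowerSeries {c ℓ : Level} (K : CommutativeRing c ℓ) where
  open CommutativeRing K hiding (zero)
  open Sym K using (Seed; sumTo; signed; negArg; delta0; IsInverseSeries)
  open FiniteSums K
  open import Relation.Binary.Reasoning.Setoid setoid
  open RingProperties ring using (-‿distribˡ-*; -‿distribʳ-*; -‿involutive; +-inverseʳ-unique)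
  open NaturalCoefficients commutativeSemiring (λ _ _ → nothing) using (solve; _:=_; _:+_; _:*_)

  infix 4 _≐_
  _≐_ : Seed → Seed → Set ℓ
  A ≐ B = ∀ n → A n ≈ B n

  infixl 7 _⋆_
  _⋆_ : Seed → Seed → Seed
  (A ⋆ B) n = sumTo n (λ k → A k * B (n ∸ k))

  euler : Seed → Seed
  euler A n = natK K n * A n

  -- Σ d_k t^k = t F′(t) / F(t)
  IsLogDerivative : Seed → Seed → Set ℓ
  IsLogDerivative d F = euler F ≐ d ⋆ F

  natK-+ : ∀ m n → natK K (m +ℕ n) ≈ natK K m + natK K n
  natK-+ zero    n = sym (+-identityˡ _)
  natK-+ (suc m) n = trans (+-congˡ (natK-+ m n)) (sym (+-assoc _ _ _))

  sign : ℕ → Carrier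
  sign k = signed k 1#

  signed≈sign* : ∀ k x → signed k x ≈ sign k * x
  signed≈sign* zero          x = sym (*-identityˡ x)
  signed≈sign* (suc zero)    x = trans (-‿cong (sym (*-identityˡ x))) (-‿distribˡ-* 1# x)
  signed≈sign* (suc (suc k)) x = signed≈sign* k x

  sign-suc : ∀ k → sign (suc k) ≈ - sign k
  sign-suc zero          = refl
  sign-suc (suc zero)    = sym (-‿involutive 1#)
  sign-suc (suc (suc k)) = sign-suc k

  sign-+ : ∀ a b → sign (a +ℕ b) ≈ sign a * sign b
  sign-+ zero    b = sym (*-identityˡ _)
  sign-+ (suc a) b = begin
    sign (suc (a +ℕ b)) ≈⟨ sign-suc (a +ℕ b) ⟩
    - sign (a +ℕ b)     ≈⟨ -‿cong (sign-+ a b) ⟩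
    - (sign a * sign b) ≈⟨ -‿distribˡ-* _ _ ⟩
    - sign a * sign b   ≈⟨ *-congʳ (sign-suc a) ⟨
    sign (suc a) * sign b ∎

  signed-involutive : ∀ k x → signed k (signed k x) ≈ x
  signed-involutive zero          x = refl
  signed-involutive (suc zero)    x = -‿involutive x
  signed-involutive (suc (suc k)) x = signed-involutive k x

  signed-suc-neg : ∀ k x → signed (suc k) (- x) ≈ signed k x
  signed-suc-neg zero          x = -‿involutive x
  signed-suc-neg (suc zero)    x = refl
  signed-suc-neg (suc (suc k)) x = signed-suc-neg k x

  signed-*-sign : ∀ k x → signed k x * sign k ≈ x
  signed-*-sign zero          x = *-identityʳ x
  signed-*-sign (suc zero)    x = begin
    - x * - 1#   ≈⟨ -‿distribʳ-* (- x) 1# ⟨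
    - (- x * 1#) ≈⟨ -‿cong (*-identityʳ (- x)) ⟩
    - (- x)      ≈⟨ -‿involutive x ⟩
    x            ∎
  signed-*-sign (suc (suc k)) x = signed-*-sign k x

  negArg-involutive : ∀ F → negArg (negArg F) ≐ F
  negArg-involutive F k = signed-involutive k (F k)

  ⋆-cong : ∀ {A A′ B B′} → A ≐ A′ → B ≐ B′ → A ⋆ B ≐ A′ ⋆ B′
  ⋆-cong A≐A′ B≐B′ n = sumTo-cong n (λ k → *-cong (A≐A′ k) (B≐B′ (n ∸ k)))

  ⋆-congˡ : ∀ A {B B′} → B ≐ B′ → A ⋆ B ≐ A ⋆ B′
  ⋆-congˡ A = ⋆-cong {A} {A} (λ _ → refl)

  ⋆-congʳ : ∀ {A A′} B → A ≐ A′ → A ⋆ B ≐ A′ ⋆ B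
  ⋆-congʳ B A≐A′ = ⋆-cong {B = B} {B′ = B} A≐A′ (λ _ → refl)

  ⋆-comm : ∀ A B → A ⋆ B ≐ B ⋆ A
  ⋆-comm A B n = begin
    sumTo n (λ k → A k * B (n ∸ k))             ≈⟨ sumTo-reverse n _ ⟩
    sumTo n (λ k → A (n ∸ k) * B (n ∸ (n ∸ k)))
      ≈⟨ sumTo-cong-≤ n (λ k k≤n →
           trans (*-comm _ _) (*-congʳ (reflexive (≡.cong B (ℕₚ.m∸[m∸n]≡n k≤n))))) ⟩
    sumTo n (λ k → B k * A (n ∸ k))             ∎

  ⋆-assoc : ∀ A B C → (A ⋆ B) ⋆ C ≐ A ⋆ (B ⋆ C)
  ⋆-assoc A B C n = begin
    sumTo n (λ m → sumTo m (λ i → A i * B (m ∸ i)) * C (n ∸ m))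
      ≈⟨ sumTo-cong-≤ n (λ m m≤n → trans (sym (sumTo-*ʳ m _ _))
           (sumTo-cong-≤ m (λ i i≤m → trans (*-assoc _ _ _)
             (*-congˡ (*-congˡ (reflexive (≡.cong C (∸-regroup m i i≤m)))))))) ⟩
    sumTo n (λ m → sumTo m (λ i → g i (m ∸ i))) ≈⟨ sumTo-triangle n g ⟩
    sumTo n (λ i → sumTo (n ∸ i) (g i))         ≈⟨ sumTo-cong n (λ i → sumTo-*ˡ (n ∸ i) (A i) _) ⟩
    sumTo n (λ i → A i * (B ⋆ C) (n ∸ i))       ∎
    where
    g : ℕ → ℕ → Carrier
    g i j = A i * (B j * C (n ∸ i ∸ j))
    ∸-regroup : ∀ m i → i ℕ.≤ m → n ∸ m ≡ n ∸ i ∸ (m ∸ i)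
    ∸-regroup m i i≤m =
      ≡.trans (≡.cong (n ∸_) (≡.sym (ℕₚ.m+[n∸m]≡n i≤m))) (≡.sym (ℕₚ.∸-+-assoc n i (m ∸ i)))

  ⋆-identityʳ : ∀ A → A ⋆ delta0 ≐ A
  ⋆-identityʳ A zero    = *-identityʳ _
  ⋆-identityʳ A (suc m) = begin
    sumTo m (λ k → A k * delta0 (suc m ∸ k)) + A (suc m) * delta0 (m ∸ m)
      ≈⟨ +-cong (sumTo-zero m (λ k k≤m → trans (*-congˡ (reflexive (delta0-suc k k≤m))) (zeroʳ _)))
                (*-congˡ (reflexive (≡.cong delta0 (ℕₚ.n∸n≡0 m)))) ⟩
    0# + A (suc m) * 1# ≈⟨ trans (+-identityˡ _) (*-identityʳ _) ⟩
    A (suc m)           ∎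
    where
    delta0-suc : ∀ k → k ℕ.≤ m → delta0 (suc m ∸ k) ≡ 0#
    delta0-suc k k≤m rewrite ℕₚ.+-∸-assoc 1 k≤m = ≡.refl

  ⋆-identityˡ : ∀ A → delta0 ⋆ A ≐ A
  ⋆-identityˡ A n = trans (⋆-comm delta0 A n) (⋆-identityʳ A n)

  euler-delta0 : euler delta0 ≐ λ _ → 0#
  euler-delta0 zero    = zeroˡ _
  euler-delta0 (suc n) = zeroʳ _

  euler-⋆ : ∀ A B n → euler (A ⋆ B) n ≈ (euler A ⋆ B) n + (A ⋆ euler B) n
  euler-⋆ A B n = begin
    natK K n * sumTo n (λ k → A k * B (n ∸ k))                ≈⟨ sumTo-*ˡ n _ _ ⟨
    sumTo n (λ k → natK K n * (A k * B (n ∸ k)))              ≈⟨ sumTo-cong-≤ n leibniz ⟩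
    sumTo n (λ k → euler A k * B (n ∸ k) + A k * euler B (n ∸ k)) ≈⟨ sumTo-+ n _ _ ⟩
    (euler A ⋆ B) n + (A ⋆ euler B) n                         ∎
    where
    leibniz : ∀ k → k ℕ.≤ n →
              natK K n * (A k * B (n ∸ k)) ≈ euler A k * B (n ∸ k) + A k * euler B (n ∸ k)
    leibniz k k≤n = trans
      (*-congʳ (trans (reflexive (≡.cong (natK K) (≡.sym (ℕₚ.m+[n∸m]≡n k≤n)))) (natK-+ k (n ∸ k))))
      (solve 4 (λ a b x y → (a :+ b) :* (x :* y) := a :* x :* y :+ x :* (b :* y)) refl _ _ _ _)

  logDerivative-cong : ∀ {d d′ F F′} → d ≐ d′ → F ≐ F′ → IsLogDerivative d F → IsLogDerivative d′ F′
  logDerivative-cong {d} {d′} {F} {F′} d≐d′ F≐F′ logD n = begin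
    natK K n * F′ n ≈⟨ *-congˡ (F≐F′ n) ⟨
    natK K n * F n  ≈⟨ logD n ⟩
    (d ⋆ F) n       ≈⟨ ⋆-cong d≐d′ F≐F′ n ⟩
    (d′ ⋆ F′) n     ∎

  logDerivative-zero : ∀ {d F} → F 0 ≈ 1# → IsLogDerivative d F → d 0 ≈ 0#
  logDerivative-zero {d} {F} F₀≈1 logD = begin
    d 0         ≈⟨ *-identityʳ _ ⟨
    d 0 * 1#    ≈⟨ *-congˡ F₀≈1 ⟨
    d 0 * F 0   ≈⟨ logD 0 ⟨
    0# * F 0    ≈⟨ zeroˡ _ ⟩
    0#          ∎

  inverseSeries-zero : ∀ {G H} → H 0 ≈ 1# → IsInverseSeries G H → G 0 ≈ 1#
  inverseSeries-zero {G} {H} H₀≈1 inv = begin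
    G 0       ≈⟨ *-identityʳ _ ⟨
    G 0 * 1#  ≈⟨ *-congˡ H₀≈1 ⟨
    G 0 * H 0 ≈⟨ inv 0 ⟩
    1#        ∎

  logDerivative-inverseˡ : ∀ {G H} → IsInverseSeries G H → IsLogDerivative (euler G ⋆ H) G
  logDerivative-inverseˡ {G} {H} inv n = sym (begin
    ((euler G ⋆ H) ⋆ G) n ≈⟨ ⋆-assoc (euler G) H G n ⟩
    (euler G ⋆ (H ⋆ G)) n ≈⟨ ⋆-congˡ (euler G) (λ k → trans (⋆-comm H G k) (inv k)) n ⟩
    (euler G ⋆ delta0) n  ≈⟨ ⋆-identityʳ (euler G) n ⟩
    euler G n             ∎)

  logDerivative-inverseʳ : ∀ {G H} → IsInverseSeries G H → IsLogDerivative (λ k → - (euler G ⋆ H) k) H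
  logDerivative-inverseʳ {G} {H} inv n = sym (begin
    ((λ k → - (euler G ⋆ H) k) ⋆ H) n ≈⟨ ⋆-congʳ H neg-euler-⋆ n ⟩
    ((G ⋆ euler H) ⋆ H) n             ≈⟨ ⋆-assoc G (euler H) H n ⟩
    (G ⋆ (euler H ⋆ H)) n             ≈⟨ ⋆-congˡ G (⋆-comm (euler H) H) n ⟩
    (G ⋆ (H ⋆ euler H)) n             ≈⟨ ⋆-assoc G H (euler H) n ⟨
    ((G ⋆ H) ⋆ euler H) n             ≈⟨ ⋆-congʳ (euler H) inv n ⟩
    (delta0 ⋆ euler H) n              ≈⟨ ⋆-identityˡ (euler H) n ⟩
    euler H n                         ∎)
    where
    -- Leibniz's rule applied to G H = 1
    neg-euler-⋆ : (λ k → - (euler G ⋆ H) k) ≐ G ⋆ euler H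
    neg-euler-⋆ k = sym (+-inverseʳ-unique _ _ (begin
      (euler G ⋆ H) k + (G ⋆ euler H) k ≈⟨ euler-⋆ G H k ⟨
      natK K k * (G ⋆ H) k              ≈⟨ *-congˡ (inv k) ⟩
      euler delta0 k                    ≈⟨ euler-delta0 k ⟩
      0#                                ∎))

  logDerivative-negArg : ∀ {d F} → IsLogDerivative d F → IsLogDerivative (negArg d) (negArg F)
  logDerivative-negArg {d} {F} logD n = begin
    natK K n * signed n (F n)   ≈⟨ *-congˡ (signed≈sign* n _) ⟩
    natK K n * (sign n * F n)   ≈⟨ solve 3 (λ a b x → a :* (b :* x) := b :* (a :* x)) refl _ _ _ ⟩
    sign n * (natK K n * F n)   ≈⟨ *-congˡ (logD n) ⟩
    sign n * (d ⋆ F) n          ≈⟨ sumTo-*ˡ n _ _ ⟨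
    sumTo n (λ k → sign n * (d k * F (n ∸ k))) ≈⟨ sumTo-cong-≤ n splitSign ⟩
    (negArg d ⋆ negArg F) n     ∎
    where
    splitSign : ∀ k → k ℕ.≤ n → sign n * (d k * F (n ∸ k)) ≈ signed k (d k) * signed (n ∸ k) (F (n ∸ k))
    splitSign k k≤n = begin
      sign n * (d k * F (n ∸ k))
        ≈⟨ *-congʳ (trans (reflexive (≡.cong sign (≡.sym (ℕₚ.m+[n∸m]≡n k≤n)))) (sign-+ k (n ∸ k))) ⟩
      (sign k * sign (n ∸ k)) * (d k * F (n ∸ k))
        ≈⟨ solve 4 (λ a b x y → (a :* b) :* (x :* y) := (a :* x) :* (b :* y)) refl _ _ _ _ ⟩
      (sign k * d k) * (sign (n ∸ k) * F (n ∸ k))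
        ≈⟨ *-cong (signed≈sign* k _) (signed≈sign* (n ∸ k) _) ⟨
      signed k (d k) * signed (n ∸ k) (F (n ∸ k)) ∎

  -- the seeds 1/(1 - t) of h and 1 + t of e, with their logarithmic derivatives
  hSeed : Seed
  hSeed _ = 1#

  hLogDerivative : Seed
  hLogDerivative zero    = 0#
  hLogDerivative (suc _) = 1#

  eSeed : Seed
  eSeed zero          = 1#
  eSeed (suc zero)    = 1#
  eSeed (suc (suc _)) = 0#

  eLogDerivative : Seed
  eLogDerivative zero    = 0#
  eLogDerivative (suc k) = sign k

  hSeed-logDerivative : IsLogDerivative hLogDerivative hSeed
  hSeed-logDerivative zero    = refl
  hSeed-logDerivative (suc m) = begin
    (1# + natK K m) * 1#                       ≈⟨ distribʳ _ _ _ ⟩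
    1# * 1# + natK K m * 1#                    ≈⟨ +-comm _ _ ⟩
    natK K m * 1# + 1# * 1#                    ≈⟨ +-congʳ (hSeed-logDerivative m) ⟩
    sumTo m (λ k → hLogDerivative k * 1#) + 1# * 1# ∎

  eSeed-logDerivative : IsLogDerivative eLogDerivative eSeed
  eSeed-logDerivative zero             = refl
  eSeed-logDerivative (suc zero)       =
    trans (*-congʳ (+-identityʳ _)) (sym (trans (+-congʳ (zeroˡ _)) (+-identityˡ _)))
  eSeed-logDerivative (suc (suc m)) = sym (begin
    sumTo (suc (suc m)) (λ k → eLogDerivative k * eSeed (suc (suc m) ∸ k))
      ≈⟨ +-assoc _ _ _ ⟩
    sumTo m (λ k → eLogDerivative k * eSeed (suc (suc m) ∸ k))
      + (sign m * eSeed (suc m ∸ m) + sign (suc m) * eSeed (m ∸ m))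
      ≈⟨ +-cong (sumTo-zero m lowerTerms) topTerms ⟩
    0# + 0#                   ≈⟨ +-identityˡ 0# ⟩
    0#                        ≈⟨ zeroʳ _ ⟨
    natK K (suc (suc m)) * 0# ∎)
    where
    lowerTerms : ∀ k → k ℕ.≤ m → eLogDerivative k * eSeed (suc (suc m) ∸ k) ≈ 0#
    lowerTerms k k≤m rewrite ℕₚ.+-∸-assoc 2 k≤m = zeroʳ _
    topTerms : sign m * eSeed (suc m ∸ m) + sign (suc m) * eSeed (m ∸ m) ≈ 0#
    topTerms rewrite ℕₚ.+-∸-assoc 1 (ℕₚ.≤-refl {m}) | ℕₚ.n∸n≡0 m = begin
      sign m * 1# + sign (suc m) * 1# ≈⟨ +-cong (*-identityʳ _) (*-identityʳ _) ⟩
      sign m + sign (suc m)           ≈⟨ +-congˡ (sign-suc m) ⟩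
      sign m + - sign m               ≈⟨ -‿inverseʳ _ ⟩
      0#                              ∎

  negArg-neg-*-eLogDerivative : ∀ (c : Seed) → c 0 ≈ 0# →
                                ∀ k → negArg (λ j → - c j) k * eLogDerivative k ≈ c k
  negArg-neg-*-eLogDerivative c c₀≈0 zero    = trans (zeroʳ _) (sym c₀≈0)
  negArg-neg-*-eLogDerivative c _    (suc k) =
    trans (*-congʳ (signed-suc-neg k (c (suc k)))) (signed-*-sign k (c (suc k)))

deg-pad : ∀ α → deg (α ++ 0 ∷ []) ≡ deg α
deg-pad []       = ≡.refl
deg-pad (a ∷ as) = ≡.cong (a +ℕ_) (deg-pad as)

deg-swapAt : ∀ i α → deg (swapAt i α) ≡ deg α
deg-swapAt zero    []           = ≡.refl
deg-swapAt zero    (a ∷ [])     = ≡.refl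
deg-swapAt zero    (a ∷ b ∷ as) = x∙yz≈y∙xz b a (deg as)
deg-swapAt (suc i) []           = ≡.refl
deg-swapAt (suc i) (a ∷ as)     = ≡.cong (a +ℕ_) (deg-swapAt i as)

deg-∷-split : ∀ {k a} β γ α → k ℕ.≤ a → deg β +ℕ deg γ ≡ deg α →
              deg (k ∷ β) +ℕ deg ((a ∸ k) ∷ γ) ≡ deg (a ∷ α)
deg-∷-split {k} {a} β γ α k≤a β+γ≡α =
  ≡.trans (interchange k (deg β) (a ∸ k) (deg γ)) (≡.cong₂ _+ℕ_ (ℕₚ.m+[n∸m]≡n k≤a) β+γ≡α)

module MultivariateSeries {c ℓ : Level} (K : CommutativeRing c ℓ) where
  open CommutativeRing K hiding (zero)
  open Sym K using (Series; _≋_; _·_; _⊛_; sumTo; oneS; prodMap; sproutCoeff)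
  open FiniteSums K
  open import Relation.Binary.Reasoning.Setoid setoid

  listSum : {A : Set} → (A → Carrier) → List A → Carrier
  listSum h xs = foldr _+_ 0# (map h xs)

  listSum-cong : {A : Set} {h h′ : A → Carrier} → (∀ x → h x ≈ h′ x) → ∀ xs → listSum h xs ≈ listSum h′ xs
  listSum-cong h≈h′ []       = refl
  listSum-cong h≈h′ (x ∷ xs) = +-cong (h≈h′ x) (listSum-cong h≈h′ xs)

  listSum-map : {A B : Set} (h : B → Carrier) (g : A → B) (xs : List A) →
                listSum h (map g xs) ≈ listSum (λ x → h (g x)) xs
  listSum-map h g []       = refl
  listSum-map h g (x ∷ xs) = +-congˡ (listSum-map h g xs)

  listSum-++ : {A : Set} (h : A → Carrier) (xs ys : List A) → listSum h (xs ++ ys) ≈ listSum h xs + listSum h ys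
  listSum-++ h []       ys = sym (+-identityˡ _)
  listSum-++ h (x ∷ xs) ys = trans (+-congˡ (listSum-++ h xs ys)) (sym (+-assoc _ _ _))

  listSum-concatMap : {A B : Set} (h : B → Carrier) (g : A → List B) (xs : List A) →
                      listSum h (concatMap g xs) ≈ listSum (λ x → listSum h (g x)) xs
  listSum-concatMap h g []       = refl
  listSum-concatMap h g (x ∷ xs) =
    trans (listSum-++ h (g x) (concatMap g xs)) (+-congˡ (listSum-concatMap h g xs))

  listSum-applyUpTo : (h : ℕ → Carrier) (f : ℕ → ℕ) (a : ℕ) →
                      listSum h (applyUpTo f (suc a)) ≈ sumTo a (λ k → h (f k))
  listSum-applyUpTo h f zero    = +-identityʳ _
  listSum-applyUpTo h f (suc a) =
    trans (+-congˡ (listSum-applyUpTo h (λ k → f (suc k)) a)) (sym (sumTo-sucˡ a (λ k → h (f k))))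

  listSum-sumTo : {A : Set} (a : ℕ) (ψ : ℕ → A → Carrier) (xs : List A) →
                  listSum (λ x → sumTo a (λ k → ψ k x)) xs ≈ sumTo a (λ k → listSum (ψ k) xs)
  listSum-sumTo a ψ []       = sym (sumTo-zero a (λ _ _ → refl))
  listSum-sumTo a ψ (x ∷ xs) = trans (+-congˡ (listSum-sumTo a ψ xs)) (sym (sumTo-+ a _ _))

  sumSplits : (Monomial → Monomial → Carrier) → Monomial → Carrier
  sumSplits φ []       = φ [] []
  sumSplits φ (a ∷ as) = sumTo a (λ k → sumSplits (λ β γ → φ (k ∷ β) ((a ∸ k) ∷ γ)) as)

  listSum-splits : ∀ α φ → listSum (λ p → φ (proj₁ p) (proj₂ p)) (splits α) ≈ sumSplits φ α
  listSum-splits []       φ = +-identityʳ _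
  listSum-splits (a ∷ as) φ = begin
    listSum h (concatMap g (splits as))        ≈⟨ listSum-concatMap h g (splits as) ⟩
    listSum (λ p → listSum h (g p)) (splits as)
      ≈⟨ listSum-cong (λ p → trans (listSum-map h _ (upTo (suc a))) (listSum-applyUpTo _ (λ k → k) a))
                      (splits as) ⟩
    listSum (λ p → sumTo a (λ k → φ (k ∷ proj₁ p) ((a ∸ k) ∷ proj₂ p))) (splits as)
      ≈⟨ listSum-sumTo a _ (splits as) ⟩
    sumTo a (λ k → listSum (λ p → φ (k ∷ proj₁ p) ((a ∸ k) ∷ proj₂ p)) (splits as))
      ≈⟨ sumTo-cong a (λ k → listSum-splits as _) ⟩
    sumSplits φ (a ∷ as)                       ∎
    where
    h : Monomial × Monomial → Carrier
    h p = φ (proj₁ p) (proj₂ p)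
    g : Monomial × Monomial → List (Monomial × Monomial)
    g p = map (λ k → (k ∷ proj₁ p) , ((a ∸ k) ∷ proj₂ p)) (upTo (suc a))

  ⊛-sumSplits : ∀ (f g : Series) α → (f ⊛ g) α ≈ sumSplits (λ β γ → f β * g γ) α
  ⊛-sumSplits f g α = listSum-splits α _

  sumSplits-cong-deg : ∀ α {φ ψ} → (∀ β γ → deg β +ℕ deg γ ≡ deg α → φ β γ ≈ ψ β γ) →
                       sumSplits φ α ≈ sumSplits ψ α
  sumSplits-cong-deg []       φ≈ψ = φ≈ψ [] [] ≡.refl
  sumSplits-cong-deg (a ∷ as) φ≈ψ = sumTo-cong-≤ a (λ k k≤a → sumSplits-cong-deg as (λ β γ β+γ≡as →
    φ≈ψ (k ∷ β) ((a ∸ k) ∷ γ) (deg-∷-split β γ as k≤a β+γ≡as)))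

  sumSplits-cong : ∀ α {φ ψ} → (∀ β γ → φ β γ ≈ ψ β γ) → sumSplits φ α ≈ sumSplits ψ α
  sumSplits-cong α φ≈ψ = sumSplits-cong-deg α (λ β γ _ → φ≈ψ β γ)

  sumSplits-zero : ∀ α {φ} → (∀ β γ → deg β +ℕ deg γ ≡ deg α → φ β γ ≈ 0#) → sumSplits φ α ≈ 0#
  sumSplits-zero []       φ≈0 = φ≈0 [] [] ≡.refl
  sumSplits-zero (a ∷ as) φ≈0 = sumTo-zero a (λ k k≤a → sumSplits-zero as (λ β γ β+γ≡as →
    φ≈0 (k ∷ β) ((a ∸ k) ∷ γ) (deg-∷-split β γ as k≤a β+γ≡as)))

  sumSplits-*ˡ : ∀ α x φ → sumSplits (λ β γ → x * φ β γ) α ≈ x * sumSplits φ α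
  sumSplits-*ˡ []       x φ = refl
  sumSplits-*ˡ (a ∷ as) x φ = trans (sumTo-cong a (λ k → sumSplits-*ˡ as x _)) (sumTo-*ˡ a x _)

  sumSplits-swapAt : ∀ i α φ → sumSplits φ (swapAt i α) ≈ sumSplits (λ β γ → φ (swapAt i β) (swapAt i γ)) α
  sumSplits-swapAt zero    []           φ = refl
  sumSplits-swapAt zero    (a ∷ [])     φ = refl
  sumSplits-swapAt zero    (a ∷ b ∷ as) φ = sumTo-swap b a _
  sumSplits-swapAt (suc i) []           φ = refl
  sumSplits-swapAt (suc i) (a ∷ as)     φ = sumTo-cong a (λ k → sumSplits-swapAt i as _)

  sumSplits-pad : ∀ α φ → sumSplits φ (α ++ 0 ∷ []) ≈ sumSplits (λ β γ → φ (β ++ 0 ∷ []) (γ ++ 0 ∷ [])) α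
  sumSplits-pad []       φ = refl
  sumSplits-pad (a ∷ as) φ = sumTo-cong a (λ k → sumSplits-pad as _)

  -- oneS, by recursion on the monomial instead of on its degree
  one : Series
  one []          = 1#
  one (zero ∷ β)  = one β
  one (suc _ ∷ β) = 0#

  one-deg : ∀ β → one β ≈ 0# ⊎ deg β ≡ 0
  one-deg []          = inj₂ ≡.refl
  one-deg (zero ∷ β)  = one-deg β
  one-deg (suc _ ∷ β) = inj₁ refl

  one-deg≡0 : ∀ β → deg β ≡ 0 → one β ≈ 1#
  one-deg≡0 []         _      = refl
  one-deg≡0 (zero ∷ β) deg≡0 = one-deg≡0 β deg≡0

  oneS≈one : oneS ≋ one
  oneS≈one α with deg α ℕ.≟ 0 | one-deg α
  ... | yes deg≡0 | _          = sym (one-deg≡0 α deg≡0)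
  ... | no  _     | inj₁ one≈0 = sym one≈0
  ... | no  deg≢0 | inj₂ deg≡0 = ⊥-elim (deg≢0 deg≡0)

  one-pad : ∀ α → one (α ++ 0 ∷ []) ≈ one α
  one-pad []          = refl
  one-pad (zero ∷ as) = one-pad as
  one-pad (suc a ∷ as) = refl

  one-swapAt : ∀ i α → one (swapAt i α) ≈ one α
  one-swapAt zero    []                   = refl
  one-swapAt zero    (a ∷ [])             = refl
  one-swapAt zero    (zero ∷ zero ∷ as)   = refl
  one-swapAt zero    (zero ∷ suc b ∷ as)  = refl
  one-swapAt zero    (suc a ∷ zero ∷ as)  = refl
  one-swapAt zero    (suc a ∷ suc b ∷ as) = refl
  one-swapAt (suc i) []                   = refl
  one-swapAt (suc i) (zero ∷ as)          = one-swapAt i as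
  one-swapAt (suc i) (suc a ∷ as)         = refl

  sumSplits-oneˡ : ∀ α (ψ : Series) → sumSplits (λ β γ → one β * ψ γ) α ≈ ψ α
  sumSplits-oneˡ []           ψ = *-identityˡ _
  sumSplits-oneˡ (zero ∷ as)  ψ = sumSplits-oneˡ as (λ γ → ψ (0 ∷ γ))
  sumSplits-oneˡ (suc a ∷ as) ψ = begin
    sumTo (suc a) (λ k → sumSplits (λ β γ → one (k ∷ β) * ψ ((suc a ∸ k) ∷ γ)) as)
      ≈⟨ sumTo-sucˡ a _ ⟩
    sumSplits (λ β γ → one β * ψ (suc a ∷ γ)) as
      + sumTo a (λ k → sumSplits (λ β γ → 0# * ψ ((a ∸ k) ∷ γ)) as)
      ≈⟨ +-cong (sumSplits-oneˡ as (λ γ → ψ (suc a ∷ γ)))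
                (sumTo-zero a (λ k _ → sumSplits-zero as (λ β γ _ → zeroˡ _))) ⟩
    ψ (suc a ∷ as) + 0# ≈⟨ +-identityʳ _ ⟩
    ψ (suc a ∷ as)      ∎

  sumSplits-oneʳ : ∀ α (ψ : Series) → sumSplits (λ β γ → ψ β * one γ) α ≈ ψ α
  sumSplits-oneʳ []           ψ = *-identityʳ _
  sumSplits-oneʳ (zero ∷ as)  ψ = sumSplits-oneʳ as (λ β → ψ (0 ∷ β))
  sumSplits-oneʳ (suc a ∷ as) ψ = begin
    sumTo a (λ k → sumSplits (λ β γ → ψ (k ∷ β) * one ((suc a ∸ k) ∷ γ)) as)
      + sumSplits (λ β γ → ψ (suc a ∷ β) * one ((a ∸ a) ∷ γ)) as
      ≈⟨ +-cong (sumTo-zero a (λ k k≤a → sumSplits-zero as (λ β γ _ →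
                   trans (*-congˡ (reflexive (one-positive k γ k≤a))) (zeroʳ _))))
                (sumSplits-cong as (λ β γ → *-congˡ (reflexive (≡.cong (λ z → one (z ∷ γ)) (ℕₚ.n∸n≡0 a))))) ⟩
    0# + sumSplits (λ β γ → ψ (suc a ∷ β) * one γ) as ≈⟨ +-identityˡ _ ⟩
    sumSplits (λ β γ → ψ (suc a ∷ β) * one γ) as      ≈⟨ sumSplits-oneʳ as (λ β → ψ (suc a ∷ β)) ⟩
    ψ (suc a ∷ as)                                    ∎
    where
    one-positive : ∀ k γ → k ℕ.≤ a → one ((suc a ∸ k) ∷ γ) ≡ 0#
    one-positive k γ k≤a rewrite ℕₚ.+-∸-assoc 1 k≤a = ≡.refl

  powerSum : ℕ → Series
  powerSum k []          = 0#
  powerSum k (zero ∷ β)  = powerSum k β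
  powerSum k (suc j ∷ β) = kronecker k (suc j) * one β

  powerSum-deg : ∀ k β → powerSum k β ≈ 0# ⊎ deg β ≡ k
  powerSum-deg k []          = inj₁ refl
  powerSum-deg k (zero ∷ β)  = powerSum-deg k β
  powerSum-deg k (suc j ∷ β) with k ℕ.≟ suc j | one-deg β
  ... | no  k≢1+j | _          = inj₁ (kronecker-≢-* k (suc j) _ k≢1+j)
  ... | yes _     | inj₁ one≈0 = inj₁ (trans (*-congˡ one≈0) (zeroʳ _))
  ... | yes k≡1+j | inj₂ deg≡0 = inj₂ (≡.trans (≡.cong (suc j +ℕ_) deg≡0)
                                                (≡.trans (ℕₚ.+-identityʳ (suc j)) (≡.sym k≡1+j)))

  powerSum-zero : ∀ β → powerSum 0 β ≈ 0#
  powerSum-zero []          = refl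
  powerSum-zero (zero ∷ β)  = powerSum-zero β
  powerSum-zero (suc j ∷ β) = zeroˡ _

  powerSum-pad : ∀ k α → powerSum k (α ++ 0 ∷ []) ≈ powerSum k α
  powerSum-pad k []           = refl
  powerSum-pad k (zero ∷ as)  = powerSum-pad k as
  powerSum-pad k (suc a ∷ as) = *-congˡ (one-pad as)

  powerSum-swapAt : ∀ k i α → powerSum k (swapAt i α) ≈ powerSum k α
  powerSum-swapAt k zero    []                   = refl
  powerSum-swapAt k zero    (a ∷ [])             = refl
  powerSum-swapAt k zero    (zero ∷ zero ∷ as)   = refl
  powerSum-swapAt k zero    (zero ∷ suc b ∷ as)  = refl
  powerSum-swapAt k zero    (suc a ∷ zero ∷ as)  = refl
  powerSum-swapAt k zero    (suc a ∷ suc b ∷ as) = trans (zeroʳ _) (sym (zeroʳ _))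
  powerSum-swapAt k (suc i) []                   = refl
  powerSum-swapAt k (suc i) (zero ∷ as)          = powerSum-swapAt k i as
  powerSum-swapAt k (suc i) (suc a ∷ as)         = *-congˡ (one-swapAt i as)

  ⊛-cong : ∀ {f f′ g g′ : Series} → f ≋ f′ → g ≋ g′ → f ⊛ g ≋ f′ ⊛ g′
  ⊛-cong {f} {f′} {g} {g′} f≋f′ g≋g′ α = begin
    (f ⊛ g) α                              ≈⟨ ⊛-sumSplits f g α ⟩
    sumSplits (λ β γ → f β * g γ) α        ≈⟨ sumSplits-cong α (λ β γ → *-cong (f≋f′ β) (g≋g′ γ)) ⟩
    sumSplits (λ β γ → f′ β * g′ γ) α      ≈⟨ ⊛-sumSplits f′ g′ α ⟨
    (f′ ⊛ g′) α                            ∎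

  ⊛-congˡ : ∀ (f : Series) {g g′} → g ≋ g′ → f ⊛ g ≋ f ⊛ g′
  ⊛-congˡ f = ⊛-cong {f} {f} (λ _ → refl)

  ⊛-congʳ : ∀ {f f′} (g : Series) → f ≋ f′ → f ⊛ g ≋ f′ ⊛ g
  ⊛-congʳ g f≋f′ = ⊛-cong {g = g} {g′ = g} f≋f′ (λ _ → refl)

  ⊛-·ˡ : ∀ a (f g : Series) → (a · f) ⊛ g ≋ a · (f ⊛ g)
  ⊛-·ˡ a f g α = begin
    ((a · f) ⊛ g) α                         ≈⟨ ⊛-sumSplits (a · f) g α ⟩
    sumSplits (λ β γ → (a * f β) * g γ) α   ≈⟨ sumSplits-cong α (λ β γ → *-assoc _ _ _) ⟩
    sumSplits (λ β γ → a * (f β * g γ)) α   ≈⟨ sumSplits-*ˡ α a _ ⟩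
    a * sumSplits (λ β γ → f β * g γ) α     ≈⟨ *-congˡ (⊛-sumSplits f g α) ⟨
    a * (f ⊛ g) α                           ∎

  ⊛-identityʳ : ∀ (f g : Series) → g ≋ oneS → f ⊛ g ≋ f
  ⊛-identityʳ f g g≋1 α = begin
    (f ⊛ g) α                         ≈⟨ ⊛-sumSplits f g α ⟩
    sumSplits (λ β γ → f β * g γ) α   ≈⟨ sumSplits-cong α (λ β γ → *-congˡ (trans (g≋1 γ) (oneS≈one γ))) ⟩
    sumSplits (λ β γ → f β * one γ) α ≈⟨ sumSplits-oneʳ α f ⟩
    f α                               ∎

  sproutCoeff-deg≡ : ∀ F n α → deg α ≡ n → sproutCoeff F n α ≈ prodMap F α
  sproutCoeff-deg≡ F n α deg≡n with deg α ℕ.≟ n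
  ... | yes _     = refl
  ... | no  deg≢n = ⊥-elim (deg≢n deg≡n)

  sproutCoeff-deg≢ : ∀ F n α → deg α ≢ n → sproutCoeff F n α ≈ 0#
  sproutCoeff-deg≢ F n α deg≢n with deg α ℕ.≟ n
  ... | yes deg≡n = ⊥-elim (deg≢n deg≡n)
  ... | no  _     = refl

  prodMap-cong : ∀ {a b : ℕ → Carrier} → (∀ k → a k ≈ b k) → ∀ α → prodMap a α ≈ prodMap b α
  prodMap-cong a≈b []      = refl
  prodMap-cong a≈b (x ∷ α) = *-cong (a≈b x) (prodMap-cong a≈b α)

  prodMap-deg≡0 : ∀ (a : ℕ → Carrier) → a 0 ≈ 1# → ∀ α → deg α ≡ 0 → prodMap a α ≈ 1#
  prodMap-deg≡0 a a₀≈1 []          _     = refl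
  prodMap-deg≡0 a a₀≈1 (zero ∷ as) deg≡0 = trans (*-cong a₀≈1 (prodMap-deg≡0 a a₀≈1 as deg≡0)) (*-identityˡ _)

  sproutCoeff-zero : ∀ F → F 0 ≈ 1# → sproutCoeff F 0 ≋ oneS
  sproutCoeff-zero F F₀≈1 α with deg α ℕ.≟ 0
  ... | yes deg≡0 = prodMap-deg≡0 F F₀≈1 α deg≡0
  ... | no  _     = refl

module NewtonIdentities {c ℓ : Level} (K : CommutativeRing c ℓ) where
  open CommutativeRing K hiding (zero)
  open Sym K using (Series; Seed; _≋_; _·_; _⊛_; sumTo; prodMap; sproutCoeff)
  open FiniteSums K
  open PowerSeries K
  open MultivariateSeries K
  open import Relation.Binary.Reasoning.Setoid setoid
  open NaturalCoefficients commutativeSemiring (λ _ _ → nothing) using (solve; _:=_; _:+_; _:*_)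

  IsNewtonSequence : (ℕ → Series) → Seed → (ℕ → Series) → Set ℓ
  IsNewtonSequence P d X = ∀ n α → natK K n * X n α ≈ sumTo n (λ k → d k * (P k ⊛ X (n ∸ k)) α)

  newton-cong : ∀ {P d X Y} → (∀ n → X n ≋ Y n) → IsNewtonSequence P d X → IsNewtonSequence P d Y
  newton-cong {P} {d} {X} {Y} X≋Y newtonX n α = begin
    natK K n * Y n α                                ≈⟨ *-congˡ (X≋Y n α) ⟨
    natK K n * X n α                                ≈⟨ newtonX n α ⟩
    sumTo n (λ k → d k * (P k ⊛ X (n ∸ k)) α)
      ≈⟨ sumTo-cong n (λ k → *-congˡ (⊛-congˡ (P k) (X≋Y (n ∸ k)) α)) ⟩
    sumTo n (λ k → d k * (P k ⊛ Y (n ∸ k)) α)       ∎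

  newton-rescale : ∀ {Q P : ℕ → Series} {d a e : Seed} {X} →
                   (∀ k → Q k ≋ a k · P k) → (∀ k → d k * a k ≈ e k) →
                   IsNewtonSequence Q d X → IsNewtonSequence P e X
  newton-rescale {Q} {P} {d} {a} {e} {X} Q≋aP da≈e newtonX n α = begin
    natK K n * X n α                                      ≈⟨ newtonX n α ⟩
    sumTo n (λ k → d k * (Q k ⊛ X (n ∸ k)) α)             ≈⟨ sumTo-cong n rescale ⟩
    sumTo n (λ k → e k * (P k ⊛ X (n ∸ k)) α)             ∎
    where
    rescale : ∀ k → d k * (Q k ⊛ X (n ∸ k)) α ≈ e k * (P k ⊛ X (n ∸ k)) α
    rescale k = begin
      d k * (Q k ⊛ X (n ∸ k)) α         ≈⟨ *-congˡ (⊛-congʳ (X (n ∸ k)) (Q≋aP k) α) ⟩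
      d k * ((a k · P k) ⊛ X (n ∸ k)) α ≈⟨ *-congˡ (⊛-·ˡ (a k) (P k) (X (n ∸ k)) α) ⟩
      d k * (a k * (P k ⊛ X (n ∸ k)) α) ≈⟨ *-assoc _ _ _ ⟨
      (d k * a k) * (P k ⊛ X (n ∸ k)) α ≈⟨ *-congʳ (da≈e k) ⟩
      e k * (P k ⊛ X (n ∸ k)) α         ∎

  module _ {F d : Seed} (F₀≈1 : F 0 ≈ 1#) (logD : IsLogDerivative d F) where

    -- p_k · ∏_i F(x_i), in all degrees at once
    powerSum⊛prod : ℕ → Series
    powerSum⊛prod k = sumSplits (λ β γ → powerSum k β * prodMap F γ)

    shiftedSeed : ℕ → ℕ → Carrier
    shiftedSeed k zero    = 0#
    shiftedSeed k (suc a) = sumTo a (λ j → kronecker k (suc j) * F (a ∸ j))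

    private
      pull-factor : ∀ k x as →
                    sumSplits (λ β γ → powerSum k β * (x * prodMap F γ)) as ≈ x * powerSum⊛prod k as
      pull-factor k x as = trans
        (sumSplits-cong as (λ β γ → solve 3 (λ p y q → p :* (y :* q) := y :* (p :* q)) refl _ _ _))
        (sumSplits-*ˡ as x _)

    powerSum⊛prod-∷ : ∀ k a as →
                      powerSum⊛prod k (a ∷ as) ≈ F a * powerSum⊛prod k as + shiftedSeed k a * prodMap F as
    powerSum⊛prod-∷ k zero    as =
      trans (pull-factor k (F 0) as) (sym (trans (+-congˡ (zeroˡ _)) (+-identityʳ _)))
    powerSum⊛prod-∷ k (suc a) as = begin
      powerSum⊛prod k (suc a ∷ as) ≈⟨ sumTo-sucˡ a _ ⟩
      sumSplits (λ β γ → powerSum k β * (F (suc a) * prodMap F γ)) as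
        + sumTo a (λ j → sumSplits (λ β γ → (kronecker k (suc j) * one β) * (F (a ∸ j) * prodMap F γ)) as)
        ≈⟨ +-cong (pull-factor k (F (suc a)) as) (sumTo-cong a (λ j → trans
             (sumSplits-cong as (λ β γ →
               solve 4 (λ e z f p → (e :* z) :* (f :* p) := z :* (e :* f :* p)) refl _ _ _ _))
             (sumSplits-oneˡ as (λ γ → kronecker k (suc j) * F (a ∸ j) * prodMap F γ)))) ⟩
      F (suc a) * powerSum⊛prod k as + sumTo a (λ j → kronecker k (suc j) * F (a ∸ j) * prodMap F as)
        ≈⟨ +-congˡ (sumTo-*ʳ a _ _) ⟩
      F (suc a) * powerSum⊛prod k as + shiftedSeed k (suc a) * prodMap F as ∎

    sumTo-*-shiftedSeed : ∀ N a → a ℕ.≤ N → sumTo N (λ k → d k * shiftedSeed k a) ≈ natK K a * F a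
    sumTo-*-shiftedSeed N zero    _   = trans (sumTo-zero N (λ k _ → zeroʳ _)) (sym (zeroˡ _))
    sumTo-*-shiftedSeed N (suc a) a<N = begin
      sumTo N (λ k → d k * sumTo a (λ j → kronecker k (suc j) * F (a ∸ j)))
        ≈⟨ sumTo-cong N (λ k → trans (sym (sumTo-*ˡ a (d k) _))
             (sumTo-cong a (λ j → solve 3 (λ x e f → x :* (e :* f) := e :* (x :* f)) refl _ _ _))) ⟩
      sumTo N (λ k → sumTo a (λ j → kronecker k (suc j) * (d k * F (a ∸ j)))) ≈⟨ sumTo-swap N a _ ⟩
      sumTo a (λ j → sumTo N (λ k → kronecker k (suc j) * (d k * F (a ∸ j))))
        ≈⟨ sumTo-cong-≤ a (λ j j≤a →
             sumTo-kronecker N (suc j) (λ k → d k * F (a ∸ j)) (ℕₚ.≤-trans (s≤s j≤a) a<N)) ⟩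
      sumTo a (λ j → d (suc j) * F (a ∸ j))                        ≈⟨ +-identityˡ _ ⟨
      0# + sumTo a (λ j → d (suc j) * F (a ∸ j))
        ≈⟨ +-congʳ (sym (trans (*-congʳ (logDerivative-zero F₀≈1 logD)) (zeroˡ _))) ⟩
      d 0 * F (suc a) + sumTo a (λ j → d (suc j) * F (a ∸ j))    ≈⟨ sumTo-sucˡ a _ ⟨
      (d ⋆ F) (suc a)                                              ≈⟨ logD (suc a) ⟨
      natK K (suc a) * F (suc a)                                   ∎

    sumTo-*-powerSum⊛prod : ∀ α N → deg α ℕ.≤ N →
                            sumTo N (λ k → d k * powerSum⊛prod k α) ≈ natK K (deg α) * prodMap F α
    sumTo-*-powerSum⊛prod []       N _ =
      trans (sumTo-zero N (λ k _ → trans (*-congˡ (zeroˡ _)) (zeroʳ _))) (sym (zeroˡ _))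
    sumTo-*-powerSum⊛prod (a ∷ as) N a+as≤N = begin
      sumTo N (λ k → d k * powerSum⊛prod k (a ∷ as))
        ≈⟨ sumTo-cong N (λ k → trans (*-congˡ (powerSum⊛prod-∷ k a as))
             (solve 5 (λ x f u w p → x :* (f :* u :+ w :* p) := f :* (x :* u) :+ p :* (x :* w))
                    refl _ _ _ _ _)) ⟩
      sumTo N (λ k → F a * (d k * powerSum⊛prod k as) + prodMap F as * (d k * shiftedSeed k a))
        ≈⟨ sumTo-+ N _ _ ⟩
      sumTo N (λ k → F a * (d k * powerSum⊛prod k as)) + sumTo N (λ k → prodMap F as * (d k * shiftedSeed k a))
        ≈⟨ +-cong (sumTo-*ˡ N _ _) (sumTo-*ˡ N _ _) ⟩
      F a * sumTo N (λ k → d k * powerSum⊛prod k as) + prodMap F as * sumTo N (λ k → d k * shiftedSeed k a)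
        ≈⟨ +-cong (*-congˡ (sumTo-*-powerSum⊛prod as N (ℕₚ.m+n≤o⇒n≤o a a+as≤N)))
                  (*-congˡ (sumTo-*-shiftedSeed N a (ℕₚ.m+n≤o⇒m≤o a a+as≤N))) ⟩
      F a * (natK K (deg as) * prodMap F as) + prodMap F as * (natK K a * F a)
        ≈⟨ solve 4 (λ f x p y → f :* (x :* p) :+ p :* (y :* f) := (y :+ x) :* (f :* p)) refl _ _ _ _ ⟩
      (natK K a + natK K (deg as)) * (F a * prodMap F as) ≈⟨ *-congʳ (natK-+ a (deg as)) ⟨
      natK K (a +ℕ deg as) * (F a * prodMap F as)         ∎

    sproutCoeff-newton : IsNewtonSequence powerSum d (sproutCoeff F)
    sproutCoeff-newton n α with deg α ℕ.≟ n
    ... | yes deg≡n = sym (begin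
      sumTo n (λ k → d k * (powerSum k ⊛ sproutCoeff F (n ∸ k)) α)
        ≈⟨ sumTo-cong n (λ k → *-congˡ (trans (⊛-sumSplits (powerSum k) _ α)
                                              (sumSplits-cong-deg α (dropDegree k)))) ⟩
      sumTo n (λ k → d k * powerSum⊛prod k α) ≈⟨ sumTo-*-powerSum⊛prod α n (ℕₚ.≤-reflexive deg≡n) ⟩
      natK K (deg α) * prodMap F α            ≈⟨ *-congʳ (reflexive (≡.cong (natK K) deg≡n)) ⟩
      natK K n * prodMap F α                  ∎)
      where
      dropDegree : ∀ k β γ → deg β +ℕ deg γ ≡ deg α →
                   powerSum k β * sproutCoeff F (n ∸ k) γ ≈ powerSum k β * prodMap F γ
      dropDegree k β γ β+γ≡α with powerSum-deg k β
      ... | inj₁ p≈0   = trans (*-congʳ p≈0) (trans (zeroˡ _) (sym (trans (*-congʳ p≈0) (zeroˡ _))))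
      ... | inj₂ deg≡k = *-congˡ (sproutCoeff-deg≡ F (n ∸ k) γ
            (≡.trans (≡.sym (ℕₚ.m+n∸m≡n k (deg γ)))
                     (≡.cong (_∸ k) (≡.trans (≡.cong (_+ℕ deg γ) (≡.sym deg≡k)) (≡.trans β+γ≡α deg≡n)))))
    ... | no deg≢n = trans (zeroʳ _) (sym (sumTo-zero n (λ k k≤n →
      trans (*-congˡ (trans (⊛-sumSplits (powerSum k) _ α) (sumSplits-zero α (vanishes k k≤n)))) (zeroʳ _))))
      where
      vanishes : ∀ k → k ℕ.≤ n → ∀ β γ → deg β +ℕ deg γ ≡ deg α →
                 powerSum k β * sproutCoeff F (n ∸ k) γ ≈ 0#
      vanishes k k≤n β γ β+γ≡α with powerSum-deg k β
      ... | inj₁ p≈0   = trans (*-congʳ p≈0) (zeroˡ _)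
      ... | inj₂ deg≡k = trans (*-congˡ (sproutCoeff-deg≢ F (n ∸ k) γ (λ γ≡n-k → deg≢n
            (≡.trans (≡.sym β+γ≡α) (≡.trans (≡.cong₂ _+ℕ_ deg≡k γ≡n-k) (ℕₚ.m+[n∸m]≡n k≤n)))))) (zeroʳ _)

  newton-unique : (∀ n {x y} → natK K (suc n) * x ≈ natK K (suc n) * y → x ≈ y) →
                  ∀ {P d X Y} → d 0 ≈ 0# → X 0 ≋ Y 0 →
                  IsNewtonSequence P d X → IsNewtonSequence P d Y → ∀ n → X n ≋ Y n
  newton-unique cancel {P} {d} {X} {Y} d₀≈0 X₀≋Y₀ newtonX newtonY = <-rec _ agree
    where
    agree : ∀ n → (∀ {j} → j ℕ.< n → X j ≋ Y j) → X n ≋ Y n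
    agree zero    _  = X₀≋Y₀
    agree (suc m) IH α = cancel m (begin
      natK K (suc m) * X (suc m) α                            ≈⟨ newtonX (suc m) α ⟩
      sumTo (suc m) (λ k → d k * (P k ⊛ X (suc m ∸ k)) α)     ≈⟨ sumTo-cong (suc m) term ⟩
      sumTo (suc m) (λ k → d k * (P k ⊛ Y (suc m ∸ k)) α)     ≈⟨ newtonY (suc m) α ⟨
      natK K (suc m) * Y (suc m) α                            ∎)
      where
      -- the k = 0 term, the only one involving X (suc m), vanishes
      term : ∀ k → d k * (P k ⊛ X (suc m ∸ k)) α ≈ d k * (P k ⊛ Y (suc m ∸ k)) α
      term zero    = trans (*-congʳ d₀≈0) (trans (zeroˡ _) (sym (trans (*-congʳ d₀≈0) (zeroˡ _))))
      term (suc k) = *-congˡ (⊛-congˡ (P (suc k)) (IH (s≤s (ℕₚ.m∸n≤m m k))) α)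

module SymmetricFunctions {c ℓ : Level} (K : CommutativeRing c ℓ) where
  open CommutativeRing K hiding (zero)
  open Sym K using (Series; _≋_; _⊕_; _·_; _⊛_; sumTo; hS; eS; prodMap; sproutCoeff; IsSymFun; Λ; ser; IsSprout)
  open PowerSeries K using (hSeed; eSeed)
  open MultivariateSeries K
  open IsSymFun

  ⊕-isSymFun : ∀ {f g} → IsSymFun f → IsSymFun g → IsSymFun (f ⊕ g)
  ⊕-isSymFun symF symG with bounded symF | bounded symG
  ... | d₁ , f≈0 | d₂ , g≈0 = record
    { padding   = λ α → +-cong (padding symF α) (padding symG α)
    ; symmetric = λ i α → +-cong (symmetric symF i α) (symmetric symG i α)
    ; bounded   = d₁ ℕ.⊔ d₂ , λ α ⊔<deg → trans
        (+-cong (f≈0 α (ℕₚ.≤-<-trans (ℕₚ.m≤m⊔n d₁ d₂) ⊔<deg))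
                (g≈0 α (ℕₚ.≤-<-trans (ℕₚ.m≤n⊔m d₁ d₂) ⊔<deg)))
        (+-identityˡ 0#)
    }

  ·-isSymFun : ∀ a {f} → IsSymFun f → IsSymFun (a · f)
  ·-isSymFun a symF with bounded symF
  ... | d , f≈0 = record
    { padding   = λ α → *-congˡ (padding symF α)
    ; symmetric = λ i α → *-congˡ (symmetric symF i α)
    ; bounded   = d , λ α d<deg → trans (*-congˡ (f≈0 α d<deg)) (zeroʳ _)
    }

  ⊛-isSymFun : ∀ {f g} → IsSymFun f → IsSymFun g → IsSymFun (f ⊛ g)
  ⊛-isSymFun {f} {g} symF symG with bounded symF | bounded symG
  ... | d₁ , f≈0 | d₂ , g≈0 = record
    { padding   = λ α → trans (⊛-sumSplits f g (α ++ 0 ∷ [])) (trans (sumSplits-pad α _)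
        (trans (sumSplits-cong α (λ β γ → *-cong (padding symF β) (padding symG γ))) (sym (⊛-sumSplits f g α))))
    ; symmetric = λ i α → trans (⊛-sumSplits f g (swapAt i α)) (trans (sumSplits-swapAt i α _)
        (trans (sumSplits-cong α (λ β γ → *-cong (symmetric symF i β) (symmetric symG i γ)))
               (sym (⊛-sumSplits f g α))))
    ; bounded   = d₁ +ℕ d₂ , λ α d<deg → trans (⊛-sumSplits f g α) (sumSplits-zero α (vanishes α d<deg))
    }
    where
    vanishes : ∀ α → d₁ +ℕ d₂ ℕ.< deg α → ∀ β γ → deg β +ℕ deg γ ≡ deg α → f β * g γ ≈ 0#
    vanishes α d<deg β γ β+γ≡α with deg β ℕ.≤? d₁ | deg γ ℕ.≤? d₂
    ... | no  β≰d₁ | _        = trans (*-congʳ (f≈0 β (ℕₚ.≰⇒> β≰d₁))) (zeroˡ _)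
    ... | yes _    | no  γ≰d₂ = trans (*-congˡ (g≈0 γ (ℕₚ.≰⇒> γ≰d₂))) (zeroʳ _)
    ... | yes β≤d₁ | yes γ≤d₂ =
          ⊥-elim (ℕₚ.<⇒≱ d<deg (≡.subst (ℕ._≤ d₁ +ℕ d₂) β+γ≡α (ℕₚ.+-mono-≤ β≤d₁ γ≤d₂)))

  powerSum-isSymFun : ∀ k → IsSymFun (powerSum k)
  powerSum-isSymFun k = record
    { padding   = powerSum-pad k
    ; symmetric = powerSum-swapAt k
    ; bounded   = k , vanishes
    }
    where
    vanishes : ∀ α → k ℕ.< deg α → powerSum k α ≈ 0#
    vanishes α k<deg with powerSum-deg k α
    ... | inj₁ p≈0   = p≈0
    ... | inj₂ deg≡k = ⊥-elim (ℕₚ.<-irrefl (≡.sym deg≡k) k<deg)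

  hS-cong-deg : ∀ n α β → deg α ≡ deg β → hS n α ≈ hS n β
  hS-cong-deg n α β α≡β with deg α ℕ.≟ n | deg β ℕ.≟ n
  ... | yes _   | yes _   = refl
  ... | no  _   | no  _   = refl
  ... | yes α≡n | no  β≢n = ⊥-elim (β≢n (≡.trans (≡.sym α≡β) α≡n))
  ... | no  α≢n | yes β≡n = ⊥-elim (α≢n (≡.trans α≡β β≡n))

  hS-isSymFun : ∀ n → IsSymFun (hS n)
  hS-isSymFun n = record
    { padding   = λ α → hS-cong-deg n (α ++ 0 ∷ []) α (deg-pad α)
    ; symmetric = λ i α → hS-cong-deg n (swapAt i α) α (deg-swapAt i α)
    ; bounded   = n , vanishes
    }
    where
    vanishes : ∀ α → n ℕ.< deg α → hS n α ≈ 0#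
    vanishes α n<deg with deg α ℕ.≟ n
    ... | yes deg≡n = ⊥-elim (ℕₚ.<-irrefl (≡.sym deg≡n) n<deg)
    ... | no  _     = refl

  _⊕Λ_ : Λ → Λ → Λ
  f ⊕Λ g = ser f ⊕ ser g , ⊕-isSymFun (proj₂ f) (proj₂ g)

  _·Λ_ : Carrier → Λ → Λ
  a ·Λ f = a · ser f , ·-isSymFun a (proj₂ f)

  _⊛Λ_ : Λ → Λ → Λ
  f ⊛Λ g = ser f ⊛ ser g , ⊛-isSymFun (proj₂ f) (proj₂ g)

  powerSumΛ : ℕ → Λ
  powerSumΛ k = powerSum k , powerSum-isSymFun k

  hΛ : ℕ → Λ
  hΛ n = hS n , hS-isSymFun n

  sumToΛ : ℕ → (ℕ → Λ) → Λ
  sumToΛ zero    g = g 0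
  sumToΛ (suc n) g = sumToΛ n g ⊕Λ g (suc n)

  ser-sumToΛ : ∀ n g α → ser (sumToΛ n g) α ≈ sumTo n (λ k → ser (g k) α)
  ser-sumToΛ zero    g α = refl
  ser-sumToΛ (suc n) g α = +-congʳ (ser-sumToΛ n g α)

  prodMap-hSeed : ∀ α → prodMap hSeed α ≈ 1#
  prodMap-hSeed []       = refl
  prodMap-hSeed (a ∷ as) = trans (*-identityˡ _) (prodMap-hSeed as)

  hΛ-sprout : IsSprout hΛ hSeed
  hΛ-sprout n α with deg α ℕ.≟ n
  ... | yes _ = sym (prodMap-hSeed α)
  ... | no  _ = refl

  eS≈sproutCoeff : ∀ n → eS n ≋ sproutCoeff eSeed n
  eS≈sproutCoeff n α with deg α ℕ.≟ n
  ... | yes _ = prodMap-cong (λ { zero → refl ; (suc zero) → refl ; (suc (suc _)) → refl }) α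
  ... | no  _ = refl

module Omega {c ℓ : Level} (K : CommutativeRing c ℓ) (ω : Sym.Λ K → Sym.Λ K) (isω : Sym.IsOmega K ω) where
  open CommutativeRing K hiding (zero)
  open Sym K using ( Seed; Series; _≋_; _·_; _⊛_; sumTo; eS; oneS; Λ; ser; negArg; sproutCoeff
                  ; IsSprout; IsOmega; IsInverseSeries)
  open IsOmega isω
  open FiniteSums K
  open PowerSeries K
  open MultivariateSeries K
  open NewtonIdentities K
  open SymmetricFunctions K
  open RingProperties ring using (+-cancelˡ)
  open import Relation.Binary.Reasoning.Setoid setoid

  ωp : ℕ → Series
  ωp k = ser (ω (powerSumΛ k))

  ω-sumToΛ : ∀ n g α → ser (ω (sumToΛ n g)) α ≈ sumTo n (λ k → ser (ω (g k)) α)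
  ω-sumToΛ zero    g α = refl
  ω-sumToΛ (suc n) g α =
    trans (ω-add (sumToΛ n g) (g (suc n)) _ (λ _ → refl) α) (+-congʳ (ω-sumToΛ n g α))

  ω-·Λ-⊛Λ : ∀ a f g α → ser (ω (a ·Λ (f ⊛Λ g))) α ≈ a * (ser (ω f) ⊛ ser (ω g)) α
  ω-·Λ-⊛Λ a f g α = trans (ω-scal a (f ⊛Λ g) _ (λ _ → refl) α) (*-congˡ (ω-mul f g _ (λ _ → refl) α))

  ω-newton : ∀ {R F d} → F 0 ≈ 1# → IsLogDerivative d F → IsSprout R F →
             IsNewtonSequence ωp d (λ n → ser (ω (R n)))
  ω-newton {R} {F} {d} F₀≈1 logD sprout n α = begin
    natK K n * ser (ω (R n)) α                                   ≈⟨ ω-scal (natK K n) (R n) newtonΛ newtonΛ≋ α ⟨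
    ser (ω newtonΛ) α                                            ≈⟨ ω-sumToΛ n _ α ⟩
    sumTo n (λ k → ser (ω (d k ·Λ (powerSumΛ k ⊛Λ R (n ∸ k)))) α)
      ≈⟨ sumTo-cong n (λ k → ω-·Λ-⊛Λ (d k) (powerSumΛ k) (R (n ∸ k)) α) ⟩
    sumTo n (λ k → d k * (ωp k ⊛ ser (ω (R (n ∸ k)))) α)        ∎
    where
    -- ω acts on Λ only, so Newton's identity for R is first assembled there
    newtonΛ : Λ
    newtonΛ = sumToΛ n (λ k → d k ·Λ (powerSumΛ k ⊛Λ R (n ∸ k)))
    newtonΛ≋ : ser newtonΛ ≋ natK K n · ser (R n)
    newtonΛ≋ β = trans (ser-sumToΛ n _ β)
      (sym (newton-cong (λ m γ → sym (sprout m γ)) (sproutCoeff-newton F₀≈1 logD) n β))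

  ωp-zero : ∀ α → ωp 0 α ≈ 0#
  ωp-zero α = trans (ω-scal 0# (powerSumΛ 0) (powerSumΛ 0) (λ β → trans (powerSum-zero β) (sym (zeroˡ _))) α)
                    (zeroˡ _)

  eS-newton : IsNewtonSequence powerSum eLogDerivative eS
  eS-newton = newton-cong (λ n α → sym (eS≈sproutCoeff n α)) (sproutCoeff-newton refl eSeed-logDerivative)

  ω-hS-newton : IsNewtonSequence ωp hLogDerivative eS
  ω-hS-newton = newton-cong (λ n → ω-h n (hΛ n) (λ _ → refl)) (ω-newton refl hSeed-logDerivative hΛ-sprout)

  eS-∸-self : ∀ m → eS (m ∸ m) ≋ oneS
  eS-∸-self m α rewrite ℕₚ.n∸n≡0 m = trans (eS≈sproutCoeff 0 α) (sproutCoeff-zero eSeed refl α)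

  -- ω of Newton's identity for h is one for e; it agrees with e's own in all but the top term
  ω-powerSum-suc : ∀ m → (∀ j → j ℕ.≤ m → ωp j ≋ eLogDerivative j · powerSum j) →
                   ωp (suc m) ≋ eLogDerivative (suc m) · powerSum (suc m)
  ω-powerSum-suc m IH α = begin
    ωp n α                                        ≈⟨ ⊛-identityʳ (ωp n) (eS (m ∸ m)) (eS-∸-self m) α ⟨
    (ωp n ⊛ eS (m ∸ m)) α                         ≈⟨ *-identityˡ _ ⟨
    hLogDerivative n * (ωp n ⊛ eS (m ∸ m)) α      ≈⟨ +-cancelˡ _ _ _ topTerms ⟩
    eLogDerivative n * (powerSum n ⊛ eS (m ∸ m)) α
      ≈⟨ *-congˡ (⊛-identityʳ (powerSum n) (eS (m ∸ m)) (eS-∸-self m) α) ⟩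
    eLogDerivative n * powerSum n α               ∎
    where
    n = suc m
    lowerTerms : ∀ k → k ℕ.≤ m →
                 hLogDerivative k * (ωp k ⊛ eS (n ∸ k)) α ≈ eLogDerivative k * (powerSum k ⊛ eS (n ∸ k)) α
    lowerTerms zero    _   = trans (zeroˡ _) (sym (zeroˡ _))
    lowerTerms (suc j) j<m = trans (*-identityˡ _)
      (trans (⊛-congʳ (eS (n ∸ suc j)) (IH (suc j) j<m) α) (⊛-·ˡ _ (powerSum (suc j)) (eS (n ∸ suc j)) α))
    topTerms : sumTo m (λ k → hLogDerivative k * (ωp k ⊛ eS (n ∸ k)) α) + hLogDerivative n * (ωp n ⊛ eS (m ∸ m)) α
             ≈ sumTo m (λ k → hLogDerivative k * (ωp k ⊛ eS (n ∸ k)) α)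
               + eLogDerivative n * (powerSum n ⊛ eS (m ∸ m)) α
    topTerms = begin
      sumTo n (λ k → hLogDerivative k * (ωp k ⊛ eS (n ∸ k)) α)       ≈⟨ ω-hS-newton n α ⟨
      natK K n * eS n α                                               ≈⟨ eS-newton n α ⟩
      sumTo n (λ k → eLogDerivative k * (powerSum k ⊛ eS (n ∸ k)) α) ≈⟨ +-congʳ (sumTo-cong-≤ m lowerTerms) ⟨
      _                                                               ∎

  ω-powerSum : ∀ k → ωp k ≋ eLogDerivative k · powerSum k
  ω-powerSum = <-rec _ λ where
    zero    _  α → trans (ωp-zero α) (sym (zeroˡ _))
    (suc m) IH   → ω-powerSum-suc m (λ j j≤m → IH (s≤s j≤m))

  ω-sprout-newton : ∀ {R F d e} → F 0 ≈ 1# → IsLogDerivative d F → IsSprout R F →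
                    (∀ k → d k * eLogDerivative k ≈ e k) → IsNewtonSequence powerSum e (λ n → ser (ω (R n)))
  ω-sprout-newton F₀≈1 logD sprout twist = newton-rescale ω-powerSum twist (ω-newton F₀≈1 logD sprout)

  ω-sprout : (∀ n {x y} → natK K (suc n) * x ≈ natK K (suc n) * y → x ≈ y) →
             ∀ {F R G} → F 0 ≈ 1# → IsSprout R F → IsInverseSeries G (negArg F) → IsSprout (λ n → ω (R n)) G
  ω-sprout cancel {F} {R} {G} F₀≈1 sprout inverse =
    newton-unique cancel dG₀≈0 ωR₀≋G₀
      (ω-sprout-newton F₀≈1 logF sprout (negArg-neg-*-eLogDerivative dG dG₀≈0))
      (sproutCoeff-newton G₀≈1 logG)
    where
    dG : Seed
    dG = euler G ⋆ negArg F

    G₀≈1 : G 0 ≈ 1#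
    G₀≈1 = inverseSeries-zero {G} {negArg F} F₀≈1 inverse

    logG : IsLogDerivative dG G
    logG = logDerivative-inverseˡ {G} {negArg F} inverse

    dG₀≈0 : dG 0 ≈ 0#
    dG₀≈0 = logDerivative-zero G₀≈1 logG

    -- F(-t) = 1/G(t) has logarithmic derivative -dG
    logF : IsLogDerivative (negArg (λ k → - dG k)) F
    logF = logDerivative-cong (λ _ → refl) (negArg-involutive F)
             (logDerivative-negArg (logDerivative-inverseʳ {G} {negArg F} inverse))

    ωR₀≋G₀ : ser (ω (R 0)) ≋ sproutCoeff G 0
    ωR₀≋G₀ α = trans (ω-one (R 0) (λ β → trans (sprout 0 β) (sproutCoeff-zero F F₀≈1 β)) α)
                     (sym (sproutCoeff-zero G G₀≈1 α))

theorem2p6 : ∀ {c ℓ} (K : CharZeroField c ℓ) →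
    let open Sym (CharZeroField.commRing K) in
      (F : Seed) → F 0 ≈ 1# →
      (R : ℕ → Λ) → IsSprout R F →
      (ω : Λ → Λ) → IsOmega ω →
      (G : Seed) → IsInverseSeries G (negArg F) →
      IsSprout (λ n → ω (R n)) G
theorem2p6 K F F₀≈1 R sprout ω isω G G⋆F[-t]≈1 =
  Omega.ω-sprout commRing ω isω natK-suc-*-cancelˡ F₀≈1 sprout G⋆F[-t]≈1
  where
  open CharZeroField K
  open CommutativeRing commRing using (_≈_; _*_)
  natK-suc-*-cancelˡ : ∀ n {x y} → natK commRing (suc n) * x ≈ natK commRing (suc n) * y → x ≈ y
  natK-suc-*-cancelˡ n = invertible-*-cancelˡ commRing (proj₂ (inverse (natK commRing (suc n)) (charZero n)))
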